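{- Define integer polynomials $G_i(x)$ by $G_0(x)=1$, $G_1(x)=x$, and $G_i(x)=xG_{i-1}(x)-G_{i-2}(x)$ for $i\geq 2$. For an integer $k$, the chain $\mathfrak{C}_k$ is the sequence $\langle G_i(k)\rangle_{i\geq 2}$. For an integer $n>1$ let $\mathcal{A}(n)=\{a\in\mathbb{Z} : 1\leq a<n,\ n \mid a^2-1,\ a\mid n^2-1\}$. Then for every integer $n>2$, the number of integers $k\geq 3$ such that $n$ appears in the chain $\mathfrak{C}_k$ equals $|\mathcal{A}(n)|-2$.
   Context: $G_i$, $\mathfrak{C}_k$ and $\mathcal{A}(n)$ are as defined in the claim. -}

module Defs where

open import Data.Nat as ℕ using (ℕ; zero; suc)
open import Data.Integer using (ℤ; +_; _+_; _-_; _*_; _≤_; _<_)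
open import Data.Integer.Divisibility using (_∣_)
open import Data.List using (List; length)
open import Data.List.Membership.Propositional using (_∈_)
open import Data.List.Relation.Unary.Unique.Propositional using (Unique)
open import Data.Product using (Σ; _×_; ∃-syntax)
open import Function.Bundles using (_⇔_)
open import Relation.Binary.PropositionalEquality using (_≡_)

G : ℕ → ℤ → ℤ
G zero          x = + 1
G (suc zero)    x = x
G (suc (suc i)) x = x * G (suc i) x - G i x

InChain : ℤ → ℤ → Set
InChain k n = ∃[ i ] (2 ℕ.≤ i × G i k ≡ n)

A : ℤ → ℤ → Set
A n a = (+ 1 ≤ a) × (a < n) × (n ∣ (a * a - + 1)) × (a ∣ (n * n - + 1))

HasSize : (ℤ → Set) → ℕ → Set
HasSize P m = Σ (List ℤ) λ L → Unique L × (∀ x → (x ∈ L) ⇔ P x) × length L ≡ m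

ChainSet : ℤ → ℤ → Set
ChainSet n k = (+ 3 ≤ k) × InChain k n

{-# OPTIONS --safe #-}
module Submission where

open import Defs
open import Data.Nat using (ℕ) renaming (_+_ to _+ℕ_)
open import Data.Integer using (ℤ; +_; _<_)
open import Data.Product using (Σ; _×_; _,_; proj₁; proj₂; ∃-syntax)

open import Data.Nat as ℕ using (zero; suc; z≤n; s≤s)
import Data.Nat.Properties as ℕₚ
open import Data.Nat.Divisibility using (_∣?_; _∣0; 1∣_)
open import Data.Nat.Induction using (<-wellFounded)
open import Induction.WellFounded using (Acc; acc)
open import Data.Integer
  using (_+_; _-_; _*_; _≤_; +≤+; +<+; ∣_∣; positive; nonNegative)
import Data.Integer.Properties as ℤ
open import Data.Integer.Divisibility using (_∣_)
open import Data.Integer.Divisibility.Signed using (divides; ∣ᵤ⇒∣; ∣⇒∣ᵤ)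
open import Data.Integer.Tactic.RingSolver using (solve)
open import Data.List using ([]; _∷_)
open import Data.Sum using (_⊎_; inj₁; inj₂; [_,_])
open import Data.Empty using (⊥-elim)
open import Function using (_∘_)
open import Function.Bundles using (_⇔_; mk⇔; Equivalence)
open import Function.Construct.Composition using (_⇔-∘_)
open import Relation.Nullary using (¬_; yes; no)
open import Relation.Nullary.Decidable using (_×-dec_; ¬?)
open import Relation.Unary using (Decidable)
open import Relation.Binary.PropositionalEquality
  using (_≡_; _≢_; refl; sym; trans; cong; cong₂; subst; ≢-sym; module ≡-Reasoning)
open ≡-Reasoning

-- Consecutive terms of C_k satisfy a² + b² - k a b = 1, and the Vieta involution
-- (a , b) ↦ (k a - b , a) of this equation walks every solution with 0 < a < b
-- down to (1 , k) = (G₀ k , G₁ k).  Hence n lies in C_k exactly when some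
-- 1 < a < n solves a² + n² - k a n = 1.  That equation makes n ∣ a² - 1 and
-- a ∣ n² - 1, and conversely every a ∈ A(n) solves it for the integer
-- k = (a² + n² - 1) / (a n).  The two elements a = 1 and a = n - 1 of A(n)
-- correspond to k = n (where n = G₁ n is not in the chain) and to k = 2.

0≤i<j⇒∣i∣<∣j∣ : ∀ {i j} → + 0 ≤ i → i < j → ∣ i ∣ ℕ.< ∣ j ∣
0≤i<j⇒∣i∣<∣j∣ (+≤+ _) (+<+ m<n) = m<n

-- A separate module keeps the overloaded constructors _∷_ of All, Unique and
-- Pointwise out of the ring solver's variable lists, where they are ambiguous.
module Counting where
  open import Data.List using (List; []; _∷_; length; map; filter; upTo)
  open import Data.List.Membership.Propositional using (_∈_)
  open import Data.List.Membership.Propositional.Properties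
    using (∈-map⁺; ∈-upTo⁺; ∈-filter⁺; ∈-filter⁻)
  open import Data.List.Relation.Unary.Any using (here; there)
  open import Data.List.Relation.Unary.All as All using (All; []; _∷_)
  open import Data.List.Relation.Unary.Unique.Propositional using (Unique; []; _∷_)
  import Data.List.Relation.Unary.Unique.Propositional.Properties as Unique
  open import Data.List.Relation.Binary.Pointwise using (Pointwise; []; _∷_; Pointwise-length)

  HasSize-cong : ∀ {P P′ : ℤ → Set} {m} → (∀ x → P x ⇔ P′ x) → HasSize P m → HasSize P′ m
  HasSize-cong P⇔P′ (xs , unique , mem , len) = xs , unique , (λ x → P⇔P′ x ⇔-∘ mem x) , len

  HasSize-insert : ∀ {P : ℤ → Set} {x m} → ¬ P x → HasSize P m →
                   HasSize (λ y → y ≡ x ⊎ P y) (suc m)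
  HasSize-insert {P} {x} ¬Px (xs , unique , mem , len) =
    x ∷ xs , All.tabulate x∉xs ∷ unique , (λ y → mk⇔ to from) , cong suc len
    where
    x∉xs : ∀ {y} → y ∈ xs → x ≢ y
    x∉xs y∈xs refl = ¬Px (Equivalence.to (mem x) y∈xs)
    to : ∀ {y} → y ∈ x ∷ xs → y ≡ x ⊎ P y
    to (here y≡x)    = inj₁ y≡x
    to (there y∈xs) = inj₂ (Equivalence.to (mem _) y∈xs)
    from : ∀ {y} → y ≡ x ⊎ P y → y ∈ x ∷ xs
    from (inj₁ y≡x) = here y≡x
    from (inj₂ Py)  = there (Equivalence.from (mem _) Py)

  HasSize-bounded : ∀ {P : ℤ → Set} → Decidable P → ∀ b →
                    (∀ {x} → P x → + 0 ≤ x × x < b) → ∃[ m ] HasSize P m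
  HasSize-bounded {P} P? b bounded = length xs , xs , unique , mem , refl
    where
    range : List ℤ
    range = map +_ (upTo ∣ b ∣)
    xs : List ℤ
    xs = filter P? range
    unique : Unique xs
    unique = Unique.filter⁺ P? (Unique.map⁺ ℤ.+-injective (Unique.upTo⁺ ∣ b ∣))
    ∈-range : ∀ {x} → + 0 ≤ x × x < b → x ∈ range
    ∈-range (0≤x , x<b) =
      subst (_∈ range) (ℤ.0≤i⇒+∣i∣≡i 0≤x) (∈-map⁺ +_ (∈-upTo⁺ (0≤i<j⇒∣i∣<∣j∣ 0≤x x<b)))
    mem : ∀ x → x ∈ xs ⇔ P x
    mem x = mk⇔ (proj₂ ∘ ∈-filter⁻ P? {xs = range})
                (λ Px → ∈-filter⁺ P? (∈-range (bounded Px)) Px)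

  record Correspondence (P P′ : ℤ → Set) : Set₁ where
    field
      _~_         : ℤ → ℤ → Set
      ~-left      : ∀ {x y} → x ~ y → P x
      ~-right     : ∀ {x y} → x ~ y → P′ y
      left-total  : ∀ {x} → P x → ∃[ y ] x ~ y
      right-total : ∀ {y} → P′ y → ∃[ x ] x ~ y
      functional  : ∀ {x y y′} → x ~ y → x ~ y′ → y ≡ y′
      injective   : ∀ {x x′ y} → x ~ y → x′ ~ y → x ≡ x′

  module _ {P P′ : ℤ → Set} (C : Correspondence P P′) where
    open Correspondence C

    private
      related-list : ∀ ys → All P′ ys → ∃[ xs ] Pointwise _~_ xs ys
      related-list []       []         = [] , []
      related-list (y ∷ ys) (P′y ∷ P′ys) =
        let x , x~y = right-total P′y ; xs , xs~ys = related-list ys P′ys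
        in x ∷ xs , x~y ∷ xs~ys

      ∈ˡ⇒related : ∀ {xs ys x} → Pointwise _~_ xs ys → x ∈ xs → ∃[ y ] y ∈ ys × x ~ y
      ∈ˡ⇒related (x~y ∷ _)     (here refl)  = _ , here refl , x~y
      ∈ˡ⇒related (_ ∷ xs~ys) (there x∈xs) =
        let y , y∈ys , x~y = ∈ˡ⇒related xs~ys x∈xs in y , there y∈ys , x~y

      ∈ʳ⇒related : ∀ {xs ys y} → Pointwise _~_ xs ys → y ∈ ys → ∃[ x ] x ∈ xs × x ~ y
      ∈ʳ⇒related (x~y ∷ _)     (here refl)  = _ , here refl , x~y
      ∈ʳ⇒related (_ ∷ xs~ys) (there y∈ys) =
        let x , x∈xs , x~y = ∈ʳ⇒related xs~ys y∈ys in x , there x∈xs , x~y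

      unique-related : ∀ {xs ys} → Pointwise _~_ xs ys → Unique ys → Unique xs
      unique-related []             []              = []
      unique-related {x ∷ xs} (x~y ∷ xs~ys) (y∉ys ∷ unique) =
        All.tabulate x∉xs ∷ unique-related xs~ys unique
        where
        x∉xs : ∀ {x′} → x′ ∈ xs → x ≢ x′
        x∉xs x′∈xs refl =
          let y′ , y′∈ys , x~y′ = ∈ˡ⇒related xs~ys x′∈xs
          in All.lookup y∉ys y′∈ys (functional x~y x~y′)

    HasSize-transport : ∀ {m} → HasSize P′ m → HasSize P m
    HasSize-transport (ys , unique , mem , len) =
      xs , unique-related xs~ys unique , (λ x → mk⇔ to from) , trans (Pointwise-length xs~ys) len
      where
      P′ys : All P′ ys
      P′ys = All.tabulate (λ {y} → Equivalence.to (mem y))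
      xs : List ℤ
      xs = proj₁ (related-list ys P′ys)
      xs~ys : Pointwise _~_ xs ys
      xs~ys = proj₂ (related-list ys P′ys)
      to : ∀ {x} → x ∈ xs → P x
      to x∈xs = ~-left (proj₂ (proj₂ (∈ˡ⇒related xs~ys x∈xs)))
      from : ∀ {x} → P x → x ∈ xs
      from Px =
        let y , x~y = left-total Px
            x′ , x′∈xs , x′~y = ∈ʳ⇒related xs~ys (Equivalence.from (mem y) (~-right x~y))
        in subst (_∈ xs) (injective x′~y x~y) x′∈xs

open Counting

-- Order facts are proved from certificates: an explicit expression for the gap that is
-- visibly nonnegative, matched against the gap by the ring solver.
≤-by : ∀ {x y} d → y - x ≡ d → + 0 ≤ d → x ≤ y
≤-by d y-x≡d 0≤d = ℤ.0≤i-j⇒j≤i (subst (+ 0 ≤_) (sym y-x≡d) 0≤d)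

<-by : ∀ {x y} d → y - (+ 1 + x) ≡ d → + 0 ≤ d → x < y
<-by d gap≡d 0≤d = ℤ.suc[i]≤j⇒i<j (≤-by d gap≡d 0≤d)

≤⇒0≤gap : ∀ {x y} → x ≤ y → + 0 ≤ y - x
≤⇒0≤gap = ℤ.i≤j⇒0≤j-i

<⇒0≤gap : ∀ {x y} → x < y → + 0 ≤ y - (+ 1 + x)
<⇒0≤gap = ℤ.i≤j⇒0≤j-i ∘ ℤ.i<j⇒suc[i]≤j

0≤-+ : ∀ {x y} → + 0 ≤ x → + 0 ≤ y → + 0 ≤ x + y
0≤-+ = ℤ.+-mono-≤

0≤-* : ∀ {x y} → + 0 ≤ x → + 0 ≤ y → + 0 ≤ x * y
0≤-* {y = y} 0≤x 0≤y = ℤ.*-monoʳ-≤-nonNeg y {{nonNegative 0≤y}} 0≤x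

0≤+_ : ∀ m → + 0 ≤ + m
0≤+ m = +≤+ z≤n

Q : ℤ → ℤ → ℤ → ℤ
Q k a b = a * a + b * b - k * a * b
-- Inlining exposes the polynomial to the ring solver; in exchange k, a, b can no
-- longer be inferred from an equation about Q, so lemmas below take them explicitly.
{-# INLINE Q #-}

Q-comm : ∀ k a b → Q k a b ≡ Q k b a
Q-comm k a b = solve (k ∷ a ∷ b ∷ [])

Q-vieta : ∀ k a b → Q k (k * b - a) b ≡ Q k a b
Q-vieta k a b = solve (k ∷ a ∷ b ∷ [])

Q≡1⇒a²-1≡[ka-b]b : ∀ k a b → Q k a b ≡ + 1 → a * a - + 1 ≡ (k * a - b) * b
Q≡1⇒a²-1≡[ka-b]b k a b Q≡1 = begin
  a * a - + 1                       ≡⟨ solve (k ∷ a ∷ b ∷ []) ⟩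
  (k * a - b) * b + (Q k a b - + 1) ≡⟨ cong (λ q → (k * a - b) * b + (q - + 1)) Q≡1 ⟩
  (k * a - b) * b + + 0             ≡⟨ ℤ.+-identityʳ _ ⟩
  (k * a - b) * b                   ∎

Q-G : ∀ k i → Q k (G i k) (G (suc i) k) ≡ + 1
Q-G k zero    = begin Q k (+ 1) k ≡⟨ solve (k ∷ []) ⟩ + 1 ∎
Q-G k (suc i) = begin
  Q k (G (suc i) k) (k * G (suc i) k - G i k) ≡⟨ Q-comm k (G (suc i) k) (G (suc (suc i)) k) ⟩
  Q k (k * G (suc i) k - G i k) (G (suc i) k) ≡⟨ Q-vieta k (G i k) (G (suc i) k) ⟩
  Q k (G i k) (G (suc i) k)                   ≡⟨ Q-G k i ⟩
  + 1                                         ∎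

b<kb-a : ∀ {k a b} → + 2 ≤ k → + 0 ≤ b → a < b → b < k * b - a
b<kb-a {k} {a} {b} 2≤k 0≤b a<b =
  <-by ((k - + 2) * b + (b - (+ 1 + a))) (solve (k ∷ a ∷ b ∷ []))
       (0≤-+ (0≤-* (≤⇒0≤gap 2≤k) 0≤b) (<⇒0≤gap a<b))

G-increasing : ∀ {k} → + 2 ≤ k → ∀ i → + 0 < G i k × G i k < G (suc i) k
G-increasing 2≤k zero    = +<+ (s≤s z≤n) , ℤ.<-≤-trans (+<+ (s≤s (s≤s z≤n))) 2≤k
G-increasing 2≤k (suc i) =
  let 0<a , a<b = G-increasing 2≤k i
      0<b = ℤ.<-trans 0<a a<b
  in 0<b , b<kb-a 2≤k (ℤ.<⇒≤ 0<b) a<b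

a²-1≡cb⇒0≤c<a : ∀ {a b c} → + 0 < a → a < b → a * a - + 1 ≡ c * b → + 0 ≤ c × c < a
a²-1≡cb⇒0≤c<a {a} {b} {c} 0<a a<b a²-1≡cb = 0≤c , c<a
  where
  0≤a : + 0 ≤ a
  0≤a = ℤ.<⇒≤ 0<a
  0<b : + 0 < b
  0<b = ℤ.<-trans 0<a a<b
  0≤a²-1 : + 0 ≤ a * a - + 1
  0≤a²-1 = ≤-by ((a - + 1) * a + (a - + 1)) (solve (a ∷ []))
    (0≤-+ (0≤-* (<⇒0≤gap 0<a) 0≤a) (<⇒0≤gap 0<a))
  0≤c : + 0 ≤ c
  0≤c = ℤ.*-cancelʳ-≤-pos (+ 0) c b {{positive 0<b}} (subst (+ 0 ≤_) a²-1≡cb 0≤a²-1)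
  a²-1<ab : a * a - + 1 < a * b
  a²-1<ab = <-by (a * (b - (+ 1 + a)) + a) (solve (a ∷ b ∷ []))
    (0≤-+ (0≤-* 0≤a (<⇒0≤gap a<b)) 0≤a)
  c<a : c < a
  c<a = ℤ.*-cancelʳ-<-nonNeg b {{nonNegative (ℤ.<⇒≤ 0<b)}} (subst (_< a * b) a²-1≡cb a²-1<ab)

a²-1≡0⇒a≡1 : ∀ {a} → + 0 < a → a * a - + 1 ≡ + 0 → a ≡ + 1
a²-1≡0⇒a≡1 {a} 0<a a²-1≡0 with ℤ.i*j≡0⇒i≡0∨j≡0 (a - + 1) [a-1][a+1]≡0
  where
  [a-1][a+1]≡0 : (a - + 1) * (a + + 1) ≡ + 0
  [a-1][a+1]≡0 = begin
    (a - + 1) * (a + + 1) ≡⟨ solve (a ∷ []) ⟩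
    a * a - + 1           ≡⟨ a²-1≡0 ⟩
    + 0                   ∎
... | inj₁ a-1≡0 = ℤ.i-j≡0⇒i≡j a (+ 1) a-1≡0
... | inj₂ a+1≡0 = ⊥-elim (ℤ.<-irrefl (sym a+1≡0) (<-by a (solve (a ∷ [])) (ℤ.<⇒≤ 0<a)))

Q≡1⇒G-consecutive : ∀ {k a b} → + 0 < a → a < b → Q k a b ≡ + 1 →
                    ∃[ i ] G i k ≡ a × G (suc i) k ≡ b
Q≡1⇒G-consecutive {a = a} = descend (<-wellFounded ∣ a ∣)
  where
  descend : ∀ {k a b} → Acc ℕ._<_ ∣ a ∣ → + 0 < a → a < b → Q k a b ≡ + 1 →
            ∃[ i ] G i k ≡ a × G (suc i) k ≡ b
  -- c stands for k * a - b, the root of Q k x a ≡ + 1 other than b.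
  descend {k} {a} {b} (acc smaller) 0<a a<b Q≡1 with k * a - b ℤ.≟ + 0
  ... | yes c≡0 = 0 , sym a≡1 , (begin
      k           ≡⟨ ℤ.*-identityʳ k ⟨
      k * + 1     ≡⟨ cong (k *_) a≡1 ⟨
      k * a       ≡⟨ ℤ.i-j≡0⇒i≡j (k * a) b c≡0 ⟩
      b           ∎)
    where
    a≡1 : a ≡ + 1
    a≡1 = a²-1≡0⇒a≡1 0<a (trans (Q≡1⇒a²-1≡[ka-b]b k a b Q≡1) (cong (_* b) c≡0))
  ... | no c≢0 =
    let 0≤c , c<a = a²-1≡cb⇒0≤c<a 0<a a<b (Q≡1⇒a²-1≡[ka-b]b k a b Q≡1)
        0<c = ℤ.≤∧≢⇒< 0≤c (c≢0 ∘ sym)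
        Q[c,a]≡1 = trans (Q-vieta k b a) (trans (Q-comm k b a) Q≡1)
        i , Gi≡c , G[1+i]≡a = descend {k} (smaller (0≤i<j⇒∣i∣<∣j∣ 0≤c c<a)) 0<c c<a Q[c,a]≡1
    in suc i , G[1+i]≡a , (begin
      k * G (suc i) k - G i k ≡⟨ cong₂ (λ x y → k * x - y) G[1+i]≡a Gi≡c ⟩
      k * a - (k * a - b)     ≡⟨ solve (k ∷ a ∷ b ∷ []) ⟩
      b                       ∎)

Consecutive : ℤ → ℤ → ℤ → Set
Consecutive k a n = + 1 < a × a < n × Q k a n ≡ + 1

Consecutive⇒InChain : ∀ {k a n} → Consecutive k a n → InChain k n
Consecutive⇒InChain {k} (1<a , a<n , Q≡1)
  with Q≡1⇒G-consecutive {k} (ℤ.<-trans (+<+ (s≤s z≤n)) 1<a) a<n Q≡1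
... | zero  , 1≡a , _        = ⊥-elim (ℤ.<-irrefl 1≡a 1<a)
... | suc i , _   , G[2+i]≡n = suc (suc i) , s≤s (s≤s z≤n) , G[2+i]≡n

InChain⇒Consecutive : ∀ {k n} → + 2 ≤ k → InChain k n → ∃[ a ] Consecutive k a n
InChain⇒Consecutive _ (suc zero , s≤s () , _)
InChain⇒Consecutive {k} 2≤k (suc (suc i) , _ , refl) =
  let 0<G[i] , G[i]<G[1+i] = G-increasing 2≤k i
  in G (suc i) k
   , ℤ.≤-<-trans (ℤ.i<j⇒suc[i]≤j 0<G[i]) G[i]<G[1+i]
   , proj₂ (G-increasing 2≤k (suc i))
   , Q-G k (suc i)

Q-cancel-k : ∀ k k′ a b → a ≢ + 0 → b ≢ + 0 → Q k a b ≡ Q k′ a b → k ≡ k′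
Q-cancel-k k k′ a b a≢0 b≢0 Q≡Q′
  with ℤ.i*j≡0⇒i≡0∨j≡0 (k′ - k) [k′-k]ab≡0
  where
  [k′-k]ab≡0 : (k′ - k) * (a * b) ≡ + 0
  [k′-k]ab≡0 = begin
    (k′ - k) * (a * b)          ≡⟨ solve (k ∷ k′ ∷ a ∷ b ∷ []) ⟩
    Q k a b - Q k′ a b          ≡⟨ ℤ.i≡j⇒i-j≡0 Q≡Q′ ⟩
    + 0                         ∎
... | inj₁ k′-k≡0 = sym (ℤ.i-j≡0⇒i≡j k′ k k′-k≡0)
... | inj₂ ab≡0 = ⊥-elim ([ a≢0 , b≢0 ] (ℤ.i*j≡0⇒i≡0∨j≡0 a ab≡0))

Q-cancel-a : ∀ k a a′ b → a + a′ ≢ k * b → Q k a b ≡ Q k a′ b → a ≡ a′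
Q-cancel-a k a a′ b a+a′≢kb Q≡Q′
  with ℤ.i*j≡0⇒i≡0∨j≡0 (a - a′) [a-a′][a+a′-kb]≡0
  where
  [a-a′][a+a′-kb]≡0 : (a - a′) * (a + a′ - k * b) ≡ + 0
  [a-a′][a+a′-kb]≡0 = begin
    (a - a′) * (a + a′ - k * b) ≡⟨ solve (k ∷ a ∷ a′ ∷ b ∷ []) ⟩
    Q k a b - Q k a′ b          ≡⟨ ℤ.i≡j⇒i-j≡0 Q≡Q′ ⟩
    + 0                         ∎
... | inj₁ a-a′≡0 = ℤ.i-j≡0⇒i≡j a a′ a-a′≡0
... | inj₂ a+a′-kb≡0 = ⊥-elim (a+a′≢kb (ℤ.i-j≡0⇒i≡j _ _ a+a′-kb≡0))

Q≡1⇒3≤k : ∀ k a b → + 0 ≤ a → + 1 + a < b → Q k a b ≡ + 1 → + 3 ≤ k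
Q≡1⇒3≤k k a b 0≤a 1+a<b Q≡1 with k ℤ.≤? + 2
... | no k≰2 = ℤ.i<j⇒suc[i]≤j (ℤ.≰⇒> k≰2)
... | yes k≤2 = ⊥-elim (ℤ.<-irrefl (sym Q≡1) 1<Q)
  where
  0≤d : + 0 ≤ b - (+ 1 + (+ 1 + a))
  0≤d = <⇒0≤gap 1+a<b
  0≤b : + 0 ≤ b
  0≤b = ℤ.≤-trans 0≤a (ℤ.≤-trans (ℤ.i≤j+i a (+ 1)) (ℤ.<⇒≤ 1+a<b))
  1<Q : + 1 < Q k a b
  1<Q = <-by (let d = b - (+ 1 + (+ 1 + a)) in d * d + + 4 * d + (+ 2 - k) * a * b + + 2)
    (solve (k ∷ a ∷ b ∷ []))
    (0≤-+ (0≤-+ (0≤-+ (0≤-* 0≤d 0≤d) (0≤-* (0≤+ 4) 0≤d))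
                (0≤-* (0≤-* (≤⇒0≤gap k≤2) 0≤a) 0≤b)) (0≤+ 2))

-- Q k (b - 1) b = 1 - (k - 2) b (b - 1).
Q[b-1,b]<1 : ∀ k b → + 3 ≤ k → + 2 ≤ b → Q k (b - + 1) b < + 1
Q[b-1,b]<1 k b 3≤k 2≤b =
  <-by (let d = b - + 2 in (k - + 3) * ((d + + 2) * (d + + 1)) + d * d + + 3 * d + + 1)
       (solve (k ∷ b ∷ []))
       (0≤-+ (0≤-+ (0≤-+ (0≤-* (≤⇒0≤gap 3≤k) (0≤-* (0≤-+ 0≤d (0≤+ 2)) (0≤-+ 0≤d (0≤+ 1))))
                         (0≤-* 0≤d 0≤d))
                   (0≤-* (0≤+ 3) 0≤d))
             (0≤+ 1))
  where
  0≤d : + 0 ≤ b - + 2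
  0≤d = ≤⇒0≤gap 2≤b

Q≡1-from-divisors : ∀ a b s t → a * a - + 1 ≡ s * b → b * b - + 1 ≡ t * a →
                    Q (b * a - s * t) a b ≡ + 1
Q≡1-from-divisors a b s t a²-1≡sb b²-1≡ta = begin
  Q (b * a - s * t) a b
    ≡⟨ solve (a ∷ b ∷ s ∷ t ∷ []) ⟩
  + 1 - ((a * a - + 1) - s * b) * (b * b - + 1) - s * b * ((b * b - + 1) - t * a)
    ≡⟨ cong₂ (λ x y → + 1 - (x - s * b) * (b * b - + 1) - s * b * (y - t * a)) a²-1≡sb b²-1≡ta ⟩
  + 1 - (s * b - s * b) * (b * b - + 1) - s * b * (t * a - t * a)
    ≡⟨ solve (a ∷ b ∷ s ∷ t ∷ []) ⟩
  + 1 ∎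

NontrivialA : ℤ → ℤ → Set
NontrivialA n a = A n a × a ≢ + 1 × a ≢ n - + 1

NontrivialA? : ∀ n → Decidable (NontrivialA n)
NontrivialA? n a =
  (+ 1 ℤ.≤? a ×-dec a ℤ.<? n ×-dec ∣ n ∣ ∣? ∣ a * a - + 1 ∣ ×-dec ∣ a ∣ ∣? ∣ n * n - + 1 ∣)
  ×-dec ¬? (a ℤ.≟ + 1) ×-dec ¬? (a ℤ.≟ n - + 1)

module _ {n : ℤ} (2<n : + 2 < n) where

  private
    0<n : + 0 < n
    0<n = ℤ.<-trans (+<+ (s≤s z≤n)) 2<n

    1<n-1 : + 1 < n - + 1
    1<n-1 = <-by (n - (+ 1 + + 2)) (solve (n ∷ [])) (<⇒0≤gap 2<n)

  _~_ : ℤ → ℤ → Set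
  k ~ a = + 3 ≤ k × Consecutive k a n

  ~⇒NontrivialA : ∀ {k a} → k ~ a → NontrivialA n a
  ~⇒NontrivialA {k} {a} (3≤k , 1<a , a<n , Q≡1) =
    (ℤ.<⇒≤ 1<a , a<n , n∣a²-1 , a∣n²-1) , ≢-sym (ℤ.<⇒≢ 1<a) , a≢n-1
    where
    n∣a²-1 : n ∣ a * a - + 1
    n∣a²-1 = ∣⇒∣ᵤ (divides (k * a - n) (Q≡1⇒a²-1≡[ka-b]b k a n Q≡1))
    a∣n²-1 : a ∣ n * n - + 1
    a∣n²-1 = ∣⇒∣ᵤ (divides (k * n - a) (Q≡1⇒a²-1≡[ka-b]b k n a (trans (Q-comm k n a) Q≡1)))
    a≢n-1 : a ≢ n - + 1
    a≢n-1 a≡n-1 = ℤ.<-irrefl Q≡1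
      (subst (λ x → Q k x n < + 1) (sym a≡n-1) (Q[b-1,b]<1 k n 3≤k (ℤ.<⇒≤ 2<n)))

  NontrivialA⇒~ : ∀ {a} → NontrivialA n a → ∃[ k ] k ~ a
  NontrivialA⇒~ {a} ((1≤a , a<n , n∣a²-1 , a∣n²-1) , a≢1 , a≢n-1)
    with ∣ᵤ⇒∣ {n} {a * a - + 1} n∣a²-1 | ∣ᵤ⇒∣ {a} {n * n - + 1} a∣n²-1
  ... | divides s a²-1≡sn | divides t n²-1≡ta =
    k , Q≡1⇒3≤k k a n (ℤ.≤-trans (0≤+ 1) 1≤a) 1+a<n Q≡1 , ℤ.≤∧≢⇒< 1≤a (≢-sym a≢1) , a<n , Q≡1
    where
    k : ℤ
    k = n * a - s * t
    Q≡1 : Q k a n ≡ + 1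
    Q≡1 = Q≡1-from-divisors a n s t a²-1≡sn n²-1≡ta
    1+a≡n⇒a≡n-1 : + 1 + a ≡ n → a ≡ n - + 1
    1+a≡n⇒a≡n-1 1+a≡n = begin
      a             ≡⟨ solve (a ∷ []) ⟩
      + 1 + a - + 1 ≡⟨ cong (_- + 1) 1+a≡n ⟩
      n - + 1       ∎
    1+a<n : + 1 + a < n
    1+a<n = ℤ.≤∧≢⇒< (ℤ.i<j⇒suc[i]≤j a<n) (a≢n-1 ∘ 1+a≡n⇒a≡n-1)

  ~-functional : ∀ {k a a′} → k ~ a → k ~ a′ → a ≡ a′
  ~-functional {k} {a} {a′} (3≤k , _ , a<n , Q≡1) (_ , _ , a′<n , Q′≡1) =
    Q-cancel-a k a a′ n (ℤ.<⇒≢ a+a′<kn) (trans Q≡1 (sym Q′≡1))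
    where
    a+a′<kn : a + a′ < k * n
    a+a′<kn = <-by ((k - + 3) * n + (n - (+ 1 + a)) + (n - (+ 1 + a′)) + n + + 1)
      (solve (k ∷ a ∷ a′ ∷ n ∷ []))
      (0≤-+ (0≤-+ (0≤-+ (0≤-+ (0≤-* (≤⇒0≤gap 3≤k) (ℤ.<⇒≤ 0<n)) (<⇒0≤gap a<n)) (<⇒0≤gap a′<n))
                   (ℤ.<⇒≤ 0<n))
             (0≤+ 1))

  ~-injective : ∀ {k k′ a} → k ~ a → k′ ~ a → k ≡ k′
  ~-injective {k} {k′} {a} (_ , 1<a , _ , Q≡1) (_ , _ , _ , Q′≡1) =
    Q-cancel-k k k′ a n (≢-sym (ℤ.<⇒≢ (ℤ.<-trans (+<+ (s≤s z≤n)) 1<a))) (≢-sym (ℤ.<⇒≢ 0<n))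
      (trans Q≡1 (sym Q′≡1))

  chain-correspondence : Correspondence (ChainSet n) (NontrivialA n)
  chain-correspondence = record
    { _~_         = _~_
    ; ~-left      = λ (3≤k , consecutive) → 3≤k , Consecutive⇒InChain consecutive
    ; ~-right     = ~⇒NontrivialA
    ; left-total  = λ (3≤k , n∈C[k]) →
        let a , consecutive = InChain⇒Consecutive (ℤ.≤-trans (+≤+ (s≤s (s≤s z≤n))) 3≤k) n∈C[k]
        in a , 3≤k , consecutive
    ; right-total = NontrivialA⇒~
    ; functional  = ~-functional
    ; injective   = ~-injective
    }

  A-split : ∀ a → (a ≡ + 1 ⊎ a ≡ n - + 1 ⊎ NontrivialA n a) ⇔ A n a
  A-split a = mk⇔ [ (λ { refl → A[1] }) , [ (λ { refl → A[n-1] }) , proj₁ ] ] classify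
    where
    A[1] : A n (+ 1)
    A[1] = ℤ.≤-refl , ℤ.<-trans (+<+ (s≤s (s≤s z≤n))) 2<n , ∣ n ∣ ∣0 , 1∣ _
    A[n-1] : A n (n - + 1)
    A[n-1] = ℤ.<⇒≤ 1<n-1
           , <-by (+ 0) (solve (n ∷ [])) ℤ.≤-refl
           , ∣⇒∣ᵤ {n} {(n - + 1) * (n - + 1) - + 1} (divides (n - + 2) (solve (n ∷ [])))
           , ∣⇒∣ᵤ {n - + 1} {n * n - + 1} (divides (n + + 1) (solve (n ∷ [])))
    classify : A n a → a ≡ + 1 ⊎ a ≡ n - + 1 ⊎ NontrivialA n a
    classify Aa with a ℤ.≟ + 1 | a ℤ.≟ n - + 1
    ... | yes a≡1 | _          = inj₁ a≡1
    ... | no a≢1 | yes a≡n-1  = inj₂ (inj₁ a≡n-1)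
    ... | no a≢1 | no a≢n-1   = inj₂ (inj₂ (Aa , a≢1 , a≢n-1))

  1∉ : ¬ (+ 1 ≡ n - + 1 ⊎ NontrivialA n (+ 1))
  1∉ = [ ℤ.<⇒≢ 1<n-1 , (λ (_ , 1≢1 , _) → 1≢1 refl) ]

  n-1∉ : ¬ NontrivialA n (n - + 1)
  n-1∉ (_ , _ , n-1≢n-1) = n-1≢n-1 refl

corollary3p3 : (n : ℤ) → + 2 < n → Σ ℕ λ m → HasSize (ChainSet n) m × HasSize (A n) (m +ℕ 2)
corollary3p3 n 2<n =
  let m , |NontrivialA|≡m = HasSize-bounded (NontrivialA? n) n
                              (λ ((1≤a , a<n , _) , _) → ℤ.≤-trans (0≤+ 1) 1≤a , a<n)
  in m
   , HasSize-transport (chain-correspondence 2<n) |NontrivialA|≡m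
   , subst (HasSize (A n)) (ℕₚ.+-comm 2 m)
       (HasSize-cong (A-split 2<n)
         (HasSize-insert (1∉ 2<n) (HasSize-insert (n-1∉ 2<n) |NontrivialA|≡m)))
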